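{- Let $p$ be an odd prime and $i,j$ positive integers with $2^j\mid p^i-1$. For every $f(x)\in A_{ij}$ we have $f(x)\mid x^{\frac12\mathrm{ord}(f(x))}+1$, and $f(x)^h\mid x^{\frac12\mathrm{ord}(f(x)^h)}+1$ for every positive integer $h$.
   Context: For $g(x)\in\mathbb{F}_p[x]$ with $g(0)\neq0$, $\mathrm{ord}(g(x))$ is the least positive integer $e$ with $g(x)\mid x^e-1$. For a positive integer $u$, $[u]_2$ is the largest $a$ with $2^a\mid u$. $A_{ij}$ is the set of monic irreducible polynomials $f(x)\in\mathbb{F}_p[x]$ of degree $i$ with $[\mathrm{ord}(f(x))]_2=j$. -}

module Defs where

open import Data.Nat using (ℕ; zero; suc; _+_; _*_; _∸_; _^_; _<_)
open import Data.Nat.Divisibility using (_∣_)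
open import Data.List using (List; []; _∷_; map; replicate; _++_)
open import Data.Product using (Σ; _×_; ∃)
open import Data.Sum using (_⊎_)
open import Relation.Nullary using (¬_)

-- Polynomials with natural-number coefficient lists (constant term first);
-- they are read as polynomials over F_p by reducing coefficients mod p.
Poly : Set
Poly = List ℕ

coeff : Poly → ℕ → ℕ
coeff []       _       = 0
coeff (a ∷ f)  zero    = a
coeff (a ∷ f)  (suc k) = coeff f k

ModEq : ℕ → ℕ → ℕ → Set
ModEq p a b = (p ∣ (a ∸ b)) × (p ∣ (b ∸ a))

_≈[_]_ : Poly → ℕ → Poly → Set
f ≈[ p ] g = ∀ k → ModEq p (coeff f k) (coeff g k)

infixl 6 _+ₚ_
infixl 7 _*ₚ_

_+ₚ_ : Poly → Poly → Poly
[]      +ₚ g       = g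
(a ∷ f) +ₚ []      = a ∷ f
(a ∷ f) +ₚ (b ∷ g) = (a + b) ∷ (f +ₚ g)

_*ₚ_ : Poly → Poly → Poly
[]      *ₚ g = []
(a ∷ f) *ₚ g = map (a *_) g +ₚ (0 ∷ (f *ₚ g))

_^ₚ_ : Poly → ℕ → Poly
f ^ₚ zero  = 1 ∷ []
f ^ₚ suc n = f *ₚ (f ^ₚ n)

X^ : ℕ → Poly
X^ e = replicate e 0 ++ (1 ∷ [])

-- x^e - 1 in F_p[x], written as x^e + (p - 1)
X^-1 : ℕ → ℕ → Poly
X^-1 p e = X^ e +ₚ ((p ∸ 1) ∷ [])

X^+1 : ℕ → Poly
X^+1 e = X^ e +ₚ (1 ∷ [])

_∣[_]_ : Poly → ℕ → Poly → Set
g ∣[ p ] f = ∃ λ q → f ≈[ p ] (g *ₚ q)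

IsZeroPoly : ℕ → Poly → Set
IsZeroPoly p f = ∀ k → p ∣ coeff f k

IsUnit : ℕ → Poly → Set
IsUnit p g = (¬ (p ∣ coeff g 0)) × (∀ k → 0 < k → p ∣ coeff g k)

MonicDeg : ℕ → ℕ → Poly → Set
MonicDeg p i f = ModEq p (coeff f i) 1 × (∀ k → i < k → p ∣ coeff f k)

Irreducible : ℕ → Poly → Set
Irreducible p f =
  (¬ IsZeroPoly p f) × (¬ IsUnit p f) ×
  (∀ g h → f ≈[ p ] (g *ₚ h) → IsUnit p g ⊎ IsUnit p h)

IsOrd : ℕ → Poly → ℕ → Set
IsOrd p g e =
  (¬ (p ∣ coeff g 0)) × (0 < e) × (g ∣[ p ] X^-1 p e) ×
  (∀ e′ → 0 < e′ → e′ < e → ¬ (g ∣[ p ] X^-1 p e′))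

Val2 : ℕ → ℕ → Set
Val2 u j = (2 ^ j ∣ u) × ¬ (2 ^ suc j ∣ u)

InA : ℕ → ℕ → ℕ → Poly → Set
InA p i j f =
  MonicDeg p i f × Irreducible p f × (∀ e → IsOrd p f e → Val2 e j) ×
  (∃ λ e → IsOrd p f e)

-- Let e = ord f, which is even since j ≥ 1, and m = e/2. Then
-- x^e − 1 = (x^m − 1)(x^m + 1) and, by minimality of e, f ∤ x^m − 1. An
-- irreducible polynomial is prime in 𝔽ₚ[x] (Bézout's identity, from the
-- Euclidean algorithm on the ideal (f, g)), so f ∣ x^m + 1.
-- For f^h the order e′ = 2m′ is a multiple of e, hence even. As p is odd,
-- x^m′ − 1 and x^m′ + 1 differ by a unit, so f divides at most one of them.
-- If it were x^m′ − 1, f^h would be coprime to x^m′ + 1 and so divide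
-- x^m′ − 1, against the minimality of e′. Hence f is coprime to x^m′ − 1 and
-- f^h ∣ x^m′ + 1.

module Submission where

open import Defs
open import Data.Nat using (ℕ; _<_; _^_; _∸_; _/_)
open import Data.Nat.Divisibility using (_∣_)
open import Data.Nat.Primality using (Prime)
open import Data.Product using (_×_)
open import Relation.Nullary using (¬_)

open import Algebra.Bundles using (CommutativeRing)
open import Data.Empty using (⊥-elim)
open import Data.List using ([]; _∷_; map; replicate; _++_; length)
open import Data.Maybe using (Maybe; just; nothing)
open import Data.Nat using (zero; suc; _+_; _*_; _≤_; _≤?_; _≟_; z≤n; s≤s; z<s; NonZero; >-nonZero; >-nonZero⁻¹; ≢-nonZero; nonTrivial⇒n>1)
open import Data.Nat.Coprimality using (prime⇒coprime; coprime-Bézout)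
open import Data.Nat.DivMod
open import Data.Nat.Divisibility using (divides; ∣-refl; ∣-trans; ∣⇒≤; m∣m*n; m%n≡0⇒n∣m; n∣m⇒m%n≡0)
open import Data.Nat.GCD using (module Bézout)
open import Data.Nat.Primality using (prime⇒nonZero; prime⇒nonTrivial)
open import Data.Nat.Properties
import Data.Nat.Tactic.RingSolver as ℕ
open import Data.Product using (∃; ∃₂; _,_; proj₁; proj₂)
open import Data.Sum using (_⊎_; inj₁; inj₂)
open import Level using (0ℓ)
open import Relation.Binary.PropositionalEquality
open import Relation.Nullary using (yes; no)
open import Relation.Nullary.Decidable using (decidable-stable)
open import Relation.Binary.Bundles using (Setoid)
import Relation.Binary.Reasoning.Setoid as SetoidReasoning
open import Tactic.RingSolver using (solve-∀; solve)
open import Tactic.RingSolver.Core.AlmostCommutativeRing using (AlmostCommutativeRing; fromCommutativeRing)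

scale : ℕ → Poly → Poly
scale a = map (a *_)

shift : ℕ → Poly → Poly
shift s g = replicate s 0 ++ g

coeff-+ₚ : ∀ f g k → coeff (f +ₚ g) k ≡ coeff f k + coeff g k
coeff-+ₚ []      g       k       = refl
coeff-+ₚ (a ∷ f) []      k       = sym (+-identityʳ _)
coeff-+ₚ (a ∷ f) (b ∷ g) zero    = refl
coeff-+ₚ (a ∷ f) (b ∷ g) (suc k) = coeff-+ₚ f g k

coeff-scale : ∀ a g k → coeff (scale a g) k ≡ a * coeff g k
coeff-scale a []      k       = sym (*-zeroʳ a)
coeff-scale a (b ∷ g) zero    = refl
coeff-scale a (b ∷ g) (suc k) = coeff-scale a g k

coeff-shift : ∀ s g t → coeff (shift s g) (s + t) ≡ coeff g t
coeff-shift zero    g t = refl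
coeff-shift (suc s) g t = coeff-shift s g t

n/2+n/2≡n : ∀ {n} → 2 ∣ n → n / 2 + n / 2 ≡ n
n/2+n/2≡n {n} 2∣n = trans (cong (n / 2 +_) (sym (+-identityʳ (n / 2)))) (m*[n/m]≡n 2∣n)

0<n/2 : ∀ {n} → 2 ∣ n → 0 < n → 0 < n / 2
0<n/2 2∣n 0<n = m≥n⇒m/n>0 (∣⇒≤ {{>-nonZero 0<n}} 2∣n)

n/2<n : ∀ {n} → 0 < n → n / 2 < n
n/2<n {n} 0<n = m/n<m n 2 {{>-nonZero 0<n}} (s≤s (s≤s z≤n))

module Modular (p : ℕ) .{{_ : NonZero p}} where

  %≡⇒∣∸ : ∀ a b → a % p ≡ b % p → p ∣ a ∸ b
  %≡⇒∣∸ a b eq = divides (a / p ∸ b / p) (begin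
      a ∸ b                                       ≡⟨ cong₂ _∸_ (m≡m%n+[m/n]*n a p) (m≡m%n+[m/n]*n b p) ⟩
      (a % p + a / p * p) ∸ (b % p + b / p * p)   ≡⟨ cong (λ r → (r + a / p * p) ∸ (b % p + b / p * p)) eq ⟩
      (b % p + a / p * p) ∸ (b % p + b / p * p)   ≡⟨ [m+n]∸[m+o]≡n∸o (b % p) _ _ ⟩
      a / p * p ∸ b / p * p                       ≡⟨ *-distribʳ-∸ p (a / p) (b / p) ⟨
      (a / p ∸ b / p) * p                         ∎)
    where open ≡-Reasoning

  ∣∸⇒%≡ : ∀ a b → b ≤ a → p ∣ a ∸ b → a % p ≡ b % p
  ∣∸⇒%≡ a b b≤a p∣a∸b = trans (cong (_% p) (sym (m∸n+n≡m b≤a))) (%-remove-+ˡ b p∣a∸b)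

  ModEq⇒%≡ : ∀ a b → ModEq p a b → a % p ≡ b % p
  ModEq⇒%≡ a b (p∣a∸b , p∣b∸a) with ≤-total a b
  ... | inj₁ a≤b = sym (∣∸⇒%≡ b a a≤b p∣b∸a)
  ... | inj₂ b≤a = ∣∸⇒%≡ a b b≤a p∣a∸b

  %≡⇒ModEq : ∀ a b → a % p ≡ b % p → ModEq p a b
  %≡⇒ModEq a b eq = %≡⇒∣∸ a b eq , %≡⇒∣∸ b a (sym eq)

  1+[p∸1]≡p : 1 + (p ∸ 1) ≡ p
  1+[p∸1]≡p = m+[n∸m]≡n (>-nonZero⁻¹ p)

  0%p≡0 : 0 % p ≡ 0
  0%p≡0 = m<n⇒m%n≡m (>-nonZero⁻¹ p)

  %-cong-+ : ∀ {x x′ y y′} → x % p ≡ x′ % p → y % p ≡ y′ % p → (x + y) % p ≡ (x′ + y′) % p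
  %-cong-+ {x} {x′} {y} {y′} eq eq′ =
    trans (%-distribˡ-+ x y p) (trans (cong₂ (λ u v → (u + v) % p) eq eq′) (sym (%-distribˡ-+ x′ y′ p)))

  %-cong-* : ∀ {x x′ y y′} → x % p ≡ x′ % p → y % p ≡ y′ % p → (x * y) % p ≡ (x′ * y′) % p
  %-cong-* {x} {x′} {y} {y′} eq eq′ =
    trans (%-distribˡ-* x y p) (trans (cong₂ (λ u v → (u * v) % p) eq eq′) (sym (%-distribˡ-* x′ y′ p)))

  -- p ∸ 1 plays the role of −1.
  x+[p∸1]*y%p≡0 : ∀ {x y} → x % p ≡ y % p → (x + (p ∸ 1) * y) % p ≡ 0
  x+[p∸1]*y%p≡0 {x} {y} eq = begin
    (x + (p ∸ 1) * y) % p      ≡⟨ %-cong-+ eq refl ⟩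
    (y + (p ∸ 1) * y) % p      ≡⟨ cong (λ q → (q + (p ∸ 1) * y) % p) (*-identityˡ y) ⟨
    (1 * y + (p ∸ 1) * y) % p  ≡⟨ cong (_% p) (*-distribʳ-+ y 1 (p ∸ 1)) ⟨
    ((1 + (p ∸ 1)) * y) % p    ≡⟨ cong (λ q → (q * y) % p) 1+[p∸1]≡p ⟩
    (p * y) % p                ≡⟨ cong (_% p) (*-comm p y) ⟩
    (y * p) % p                ≡⟨ m*n%n≡0 y p ⟩
    0                          ∎
    where open ≡-Reasoning

  %-inverse : Prime p → ∀ a → ¬ (a % p ≡ 0) → ∃ λ b → (a * b) % p ≡ 1 % p
  %-inverse p-prime a a≢0 =
    from-Bézout (coprime-Bézout (prime⇒coprime p-prime {{≢-nonZero a≢0}} (m%n<n a p)))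
    where
    open ≡-Reasoning
    r = a % p
    q = p ∸ 1
    a*b≡r*b : ∀ b → (a * b) % p ≡ (r * b) % p
    a*b≡r*b b = %-cong-* (sym (m%n%n≡m%n a p)) refl
    from-Bézout : Bézout.Identity 1 p r → ∃ λ b → (a * b) % p ≡ 1 % p
    from-Bézout (Bézout.-+ x y eq) = y , (begin
      (a * y) % p      ≡⟨ a*b≡r*b y ⟩
      (r * y) % p      ≡⟨ cong (_% p) (*-comm r y) ⟩
      (y * r) % p      ≡⟨ cong (_% p) eq ⟨
      (1 + x * p) % p  ≡⟨ [m+kn]%n≡m%n 1 x p ⟩
      1 % p            ∎)
    -- Here r * y ≡ −1, so q = p ∸ 1 ≡ −1 turns y into an inverse.
    from-Bézout (Bézout.+- x y eq) = q * y , (begin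
      (a * (q * y)) % p          ≡⟨ a*b≡r*b _ ⟩
      (r * (q * y)) % p          ≡⟨ [m+kn]%n≡m%n _ 1 p ⟨
      (r * (q * y) + 1 * p) % p  ≡⟨ cong (_% p) r*q*y+p≡1+q*x*p ⟩
      (1 + q * x * p) % p        ≡⟨ [m+kn]%n≡m%n 1 (q * x) p ⟩
      1 % p                      ∎)
      where
      r*q*y+p≡1+q*x*p : r * (q * y) + 1 * p ≡ 1 + q * x * p
      r*q*y+p≡1+q*x*p = begin
        r * (q * y) + 1 * p        ≡⟨ cong (λ n → r * (q * y) + 1 * n) 1+[p∸1]≡p ⟨
        r * (q * y) + 1 * (1 + q)  ≡⟨ expand r q y ⟩
        1 + q * (1 + y * r)        ≡⟨ cong (λ n → 1 + q * n) eq ⟩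
        1 + q * (x * p)            ≡⟨ cong suc (*-assoc q x p) ⟨
        1 + q * x * p              ∎
        where
        expand : ∀ r q y → r * (q * y) + 1 * (1 + q) ≡ 1 + q * (1 + y * r)
        expand = ℕ.solve-∀

-- 𝔽ₚ[x] as Poly up to coefficientwise congruence mod p

module Polynomials (p : ℕ) .{{_ : NonZero p}} where

  open Modular p

  infix 4 _≋_
  record _≋_ (f g : Poly) : Set where
    constructor mk≋
    field coeff-≋ : ∀ k → coeff f k % p ≡ coeff g k % p
  open _≋_ public

  ≋-refl : ∀ {f} → f ≋ f
  ≋-refl = mk≋ λ k → refl

  ≋-sym : ∀ {f g} → f ≋ g → g ≋ f
  ≋-sym f≋g = mk≋ λ k → sym (coeff-≋ f≋g k)

  ≋-trans : ∀ {f g h} → f ≋ g → g ≋ h → f ≋ h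
  ≋-trans f≋g g≋h = mk≋ λ k → trans (coeff-≋ f≋g k) (coeff-≋ g≋h k)

  ≋-setoid : Setoid 0ℓ 0ℓ
  ≋-setoid = record { _≈_ = _≋_ ; isEquivalence = record { refl = ≋-refl ; sym = ≋-sym ; trans = ≋-trans } }

  module ≋-Reasoning = SetoidReasoning ≋-setoid

  coeff-≡⇒≋ : ∀ {f g} → (∀ k → coeff f k ≡ coeff g k) → f ≋ g
  coeff-≡⇒≋ eq = mk≋ λ k → cong (_% p) (eq k)

  ≈⇒≋ : ∀ {f g} → f ≈[ p ] g → f ≋ g
  ≈⇒≋ f≈g = mk≋ λ k → ModEq⇒%≡ _ _ (f≈g k)

  ≋⇒≈ : ∀ {f g} → f ≋ g → f ≈[ p ] g
  ≋⇒≈ f≋g k = %≡⇒ModEq _ _ (coeff-≋ f≋g k)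

  ∷-cong : ∀ {a b f g} → a % p ≡ b % p → f ≋ g → (a ∷ f) ≋ (b ∷ g)
  ∷-cong a≡b f≋g = mk≋ λ { zero → a≡b ; (suc k) → coeff-≋ f≋g k }

  ∷-tail : ∀ {a b f g} → (a ∷ f) ≋ (b ∷ g) → f ≋ g
  ∷-tail eq = mk≋ λ k → coeff-≋ eq (suc k)

  []≋0∷[] : [] ≋ (0 ∷ [])
  []≋0∷[] = mk≋ λ { zero → refl ; (suc k) → refl }

  +ₚ-cong : ∀ {f f′ g g′} → f ≋ f′ → g ≋ g′ → f +ₚ g ≋ f′ +ₚ g′
  +ₚ-cong {f} {f′} {g} {g′} f≋f′ g≋g′ = mk≋ λ k → begin
      coeff (f +ₚ g) k % p            ≡⟨ cong (_% p) (coeff-+ₚ f g k) ⟩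
      (coeff f k + coeff g k) % p     ≡⟨ %-cong-+ (coeff-≋ f≋f′ k) (coeff-≋ g≋g′ k) ⟩
      (coeff f′ k + coeff g′ k) % p   ≡⟨ cong (_% p) (coeff-+ₚ f′ g′ k) ⟨
      coeff (f′ +ₚ g′) k % p          ∎
    where open ≡-Reasoning

  scale-cong : ∀ {a b f f′} → a % p ≡ b % p → f ≋ f′ → scale a f ≋ scale b f′
  scale-cong {a} {b} {f} {f′} a≡b f≋f′ = mk≋ λ k → begin
      coeff (scale a f) k % p   ≡⟨ cong (_% p) (coeff-scale a f k) ⟩
      (a * coeff f k) % p       ≡⟨ %-cong-* a≡b (coeff-≋ f≋f′ k) ⟩
      (b * coeff f′ k) % p      ≡⟨ cong (_% p) (coeff-scale b f′ k) ⟨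
      coeff (scale b f′) k % p  ∎
    where open ≡-Reasoning

  +ₚ-assoc : ∀ f g h → (f +ₚ g) +ₚ h ≋ f +ₚ (g +ₚ h)
  +ₚ-assoc f g h = coeff-≡⇒≋ λ k → begin
      coeff ((f +ₚ g) +ₚ h) k              ≡⟨ coeff-+ₚ (f +ₚ g) h k ⟩
      coeff (f +ₚ g) k + coeff h k         ≡⟨ cong (_+ coeff h k) (coeff-+ₚ f g k) ⟩
      coeff f k + coeff g k + coeff h k    ≡⟨ +-assoc (coeff f k) _ _ ⟩
      coeff f k + (coeff g k + coeff h k)  ≡⟨ cong (coeff f k +_) (coeff-+ₚ g h k) ⟨
      coeff f k + coeff (g +ₚ h) k         ≡⟨ coeff-+ₚ f (g +ₚ h) k ⟨
      coeff (f +ₚ (g +ₚ h)) k              ∎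
    where open ≡-Reasoning

  +ₚ-comm : ∀ f g → f +ₚ g ≋ g +ₚ f
  +ₚ-comm f g = coeff-≡⇒≋ λ k →
    trans (coeff-+ₚ f g k) (trans (+-comm (coeff f k) _) (sym (coeff-+ₚ g f k)))

  +ₚ-identityʳ : ∀ f → f +ₚ [] ≋ f
  +ₚ-identityʳ f = coeff-≡⇒≋ λ k → trans (coeff-+ₚ f [] k) (+-identityʳ _)

  +ₚ-left-comm : ∀ f g h → f +ₚ (g +ₚ h) ≋ g +ₚ (f +ₚ h)
  +ₚ-left-comm f g h =
    ≋-trans (≋-sym (+ₚ-assoc f g h)) (≋-trans (+ₚ-cong (+ₚ-comm f g) ≋-refl) (+ₚ-assoc g f h))

  +ₚ-interchange : ∀ f g h k → (f +ₚ g) +ₚ (h +ₚ k) ≋ (f +ₚ h) +ₚ (g +ₚ k)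
  +ₚ-interchange f g h k =
    ≋-trans (+ₚ-assoc f g (h +ₚ k))
      (≋-trans (+ₚ-cong (≋-refl {f}) (+ₚ-left-comm g h k)) (≋-sym (+ₚ-assoc f h (g +ₚ k))))

  scale-distribˡ : ∀ a f g → scale a (f +ₚ g) ≋ scale a f +ₚ scale a g
  scale-distribˡ a f g = coeff-≡⇒≋ λ k → begin
      coeff (scale a (f +ₚ g)) k                 ≡⟨ coeff-scale a (f +ₚ g) k ⟩
      a * coeff (f +ₚ g) k                       ≡⟨ cong (a *_) (coeff-+ₚ f g k) ⟩
      a * (coeff f k + coeff g k)                ≡⟨ *-distribˡ-+ a (coeff f k) _ ⟩
      a * coeff f k + a * coeff g k              ≡⟨ cong₂ _+_ (coeff-scale a f k) (coeff-scale a g k) ⟨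
      coeff (scale a f) k + coeff (scale a g) k  ≡⟨ coeff-+ₚ (scale a f) (scale a g) k ⟨
      coeff (scale a f +ₚ scale a g) k           ∎
    where open ≡-Reasoning

  scale-distribʳ : ∀ a b f → scale (a + b) f ≋ scale a f +ₚ scale b f
  scale-distribʳ a b f = coeff-≡⇒≋ λ k → begin
      coeff (scale (a + b) f) k                  ≡⟨ coeff-scale (a + b) f k ⟩
      (a + b) * coeff f k                        ≡⟨ *-distribʳ-+ (coeff f k) a b ⟩
      a * coeff f k + b * coeff f k              ≡⟨ cong₂ _+_ (coeff-scale a f k) (coeff-scale b f k) ⟨
      coeff (scale a f) k + coeff (scale b f) k  ≡⟨ coeff-+ₚ (scale a f) (scale b f) k ⟨
      coeff (scale a f +ₚ scale b f) k           ∎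
    where open ≡-Reasoning

  scale-scale : ∀ a b f → scale a (scale b f) ≋ scale (a * b) f
  scale-scale a b f = coeff-≡⇒≋ λ k → begin
      coeff (scale a (scale b f)) k  ≡⟨ coeff-scale a (scale b f) k ⟩
      a * coeff (scale b f) k        ≡⟨ cong (a *_) (coeff-scale b f k) ⟩
      a * (b * coeff f k)            ≡⟨ *-assoc a b _ ⟨
      a * b * coeff f k              ≡⟨ coeff-scale (a * b) f k ⟨
      coeff (scale (a * b) f) k      ∎
    where open ≡-Reasoning

  scale-zero : ∀ f → scale 0 f ≋ []
  scale-zero f = coeff-≡⇒≋ (coeff-scale 0 f)

  *ₚ-zeroˡ-≋ : ∀ f g → [] ≋ f → [] ≋ f *ₚ g
  *ₚ-zeroˡ-≋ []      g _ = ≋-refl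
  *ₚ-zeroˡ-≋ (b ∷ f) g 0≋b∷f = ≋-sym (begin
      scale b g +ₚ (0 ∷ f *ₚ g)  ≈⟨ +ₚ-cong (scale-cong (sym (coeff-≋ 0≋b∷f zero)) ≋-refl) (∷-cong refl (≋-sym 0≋f*g)) ⟩
      scale 0 g +ₚ (0 ∷ [])      ≈⟨ +ₚ-cong (scale-zero g) ≋-refl ⟩
      0 ∷ []                     ≈⟨ []≋0∷[] ⟨
      []                         ∎)
    where
    open ≋-Reasoning
    0≋f*g : [] ≋ f *ₚ g
    0≋f*g = *ₚ-zeroˡ-≋ f g (∷-tail (≋-trans (≋-sym []≋0∷[]) 0≋b∷f))

  *ₚ-congˡ : ∀ f f′ g → f ≋ f′ → f *ₚ g ≋ f′ *ₚ g
  *ₚ-congˡ []      f′       g f≋f′ = *ₚ-zeroˡ-≋ f′ g f≋f′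
  *ₚ-congˡ (a ∷ f) []       g f≋f′ = ≋-sym (*ₚ-zeroˡ-≋ (a ∷ f) g (≋-sym f≋f′))
  *ₚ-congˡ (a ∷ f) (b ∷ f′) g f≋f′ =
    +ₚ-cong (scale-cong (coeff-≋ f≋f′ zero) ≋-refl) (∷-cong refl (*ₚ-congˡ f f′ g (∷-tail f≋f′)))

  *ₚ-congʳ : ∀ f g g′ → g ≋ g′ → f *ₚ g ≋ f *ₚ g′
  *ₚ-congʳ []      g g′ g≋g′ = ≋-refl
  *ₚ-congʳ (a ∷ f) g g′ g≋g′ = +ₚ-cong (scale-cong {a} refl g≋g′) (∷-cong refl (*ₚ-congʳ f g g′ g≋g′))

  *ₚ-cong : ∀ {f f′ g g′} → f ≋ f′ → g ≋ g′ → f *ₚ g ≋ f′ *ₚ g′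
  *ₚ-cong {f} {f′} {g} {g′} f≋f′ g≋g′ = ≋-trans (*ₚ-congˡ f f′ g f≋f′) (*ₚ-congʳ f′ g g′ g≋g′)

  *ₚ-distribʳ : ∀ f g h → (f +ₚ g) *ₚ h ≋ f *ₚ h +ₚ g *ₚ h
  *ₚ-distribʳ []      g       h = ≋-refl
  *ₚ-distribʳ (a ∷ f) []      h = ≋-sym (+ₚ-identityʳ _)
  *ₚ-distribʳ (a ∷ f) (b ∷ g) h =
    ≋-trans (+ₚ-cong (scale-distribʳ a b h) (∷-cong refl (*ₚ-distribʳ f g h)))
            (+ₚ-interchange (scale a h) (scale b h) (0 ∷ f *ₚ h) (0 ∷ g *ₚ h))

  scale-*ₚ : ∀ a g h → scale a g *ₚ h ≋ scale a (g *ₚ h)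
  scale-*ₚ a []      h = ≋-refl
  scale-*ₚ a (b ∷ g) h = ≋-sym (≋-trans (scale-distribˡ a (scale b h) (0 ∷ g *ₚ h))
    (+ₚ-cong (scale-scale a b h) (∷-cong (cong (_% p) (*-zeroʳ a)) (≋-sym (scale-*ₚ a g h)))))

  *ₚ-zeroʳ : ∀ g → g *ₚ [] ≋ []
  *ₚ-zeroʳ []      = ≋-refl
  *ₚ-zeroʳ (a ∷ g) = ≋-trans (∷-cong refl (*ₚ-zeroʳ g)) (≋-sym []≋0∷[])

  *ₚ-∷ʳ : ∀ f b g → f *ₚ (b ∷ g) ≋ scale b f +ₚ (0 ∷ f *ₚ g)
  *ₚ-∷ʳ []      b g = []≋0∷[]
  *ₚ-∷ʳ (a ∷ f) b g = ∷-cong (cong (λ x → (x + 0) % p) (*-comm a b))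
    (≋-trans (+ₚ-cong ≋-refl (*ₚ-∷ʳ f b g)) (+ₚ-left-comm (scale a g) (scale b f) (0 ∷ f *ₚ g)))

  *ₚ-comm : ∀ f g → f *ₚ g ≋ g *ₚ f
  *ₚ-comm []      g = ≋-sym (*ₚ-zeroʳ g)
  *ₚ-comm (a ∷ f) g = ≋-sym (≋-trans (*ₚ-∷ʳ g a f) (+ₚ-cong ≋-refl (∷-cong refl (*ₚ-comm g f))))

  *ₚ-assoc : ∀ f g h → (f *ₚ g) *ₚ h ≋ f *ₚ (g *ₚ h)
  *ₚ-assoc []      g h = ≋-refl
  *ₚ-assoc (a ∷ f) g h = ≋-trans (*ₚ-distribʳ (scale a g) (0 ∷ f *ₚ g) h)
    (+ₚ-cong (scale-*ₚ a g h) (≋-trans (+ₚ-cong (scale-zero h) ≋-refl) (∷-cong refl (*ₚ-assoc f g h))))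

  C : ℕ → Poly
  C a = a ∷ []

  C*ₚ≋scale : ∀ a h → C a *ₚ h ≋ scale a h
  C*ₚ≋scale a h = ≋-trans (+ₚ-cong (≋-refl {scale a h}) (≋-sym []≋0∷[])) (+ₚ-identityʳ (scale a h))

  *ₚ-identityˡ : ∀ g → C 1 *ₚ g ≋ g
  *ₚ-identityˡ g = ≋-trans (C*ₚ≋scale 1 g) (coeff-≡⇒≋ λ k → trans (coeff-scale 1 g k) (*-identityˡ _))

  -ₚ_ : Poly → Poly
  -ₚ_ = scale (p ∸ 1)

  -ₚ-inverseˡ : ∀ f → (-ₚ f) +ₚ f ≋ []
  -ₚ-inverseˡ f = mk≋ λ k → begin
      coeff ((-ₚ f) +ₚ f) k % p               ≡⟨ cong (_% p) (coeff-+ₚ (-ₚ f) f k) ⟩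
      (coeff (-ₚ f) k + coeff f k) % p         ≡⟨ cong (λ x → (x + coeff f k) % p) (coeff-scale (p ∸ 1) f k) ⟩
      ((p ∸ 1) * coeff f k + coeff f k) % p    ≡⟨ cong (_% p) (+-comm ((p ∸ 1) * coeff f k) _) ⟩
      (coeff f k + (p ∸ 1) * coeff f k) % p    ≡⟨ x+[p∸1]*y%p≡0 refl ⟩
      0                                        ≡⟨ 0%p≡0 ⟨
      0 % p                                    ∎
    where open ≡-Reasoning

  *ₚ-distribˡ : ∀ f g h → f *ₚ (g +ₚ h) ≋ f *ₚ g +ₚ f *ₚ h
  *ₚ-distribˡ f g h =
    ≋-trans (*ₚ-comm f _) (≋-trans (*ₚ-distribʳ g h f) (+ₚ-cong (*ₚ-comm g f) (*ₚ-comm h f)))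

  +ₚ-*ₚ-commutativeRing : CommutativeRing 0ℓ 0ℓ
  +ₚ-*ₚ-commutativeRing = record
    { Carrier = Poly ; _≈_ = _≋_ ; _+_ = _+ₚ_ ; _*_ = _*ₚ_ ; -_ = -ₚ_ ; 0# = [] ; 1# = C 1
    ; isCommutativeRing = record
      { isRing = record
        { +-isAbelianGroup = record
          { isGroup = record
            { isMonoid = record
              { isSemigroup = record
                { isMagma = record { isEquivalence = Setoid.isEquivalence ≋-setoid ; ∙-cong = +ₚ-cong }
                ; assoc = +ₚ-assoc }
              ; identity = (λ f → ≋-refl) , +ₚ-identityʳ }
            ; inverse = -ₚ-inverseˡ , (λ f → ≋-trans (+ₚ-comm f (-ₚ f)) (-ₚ-inverseˡ f))
            ; ⁻¹-cong = scale-cong {p ∸ 1} refl }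
          ; comm = +ₚ-comm }
        ; *-cong = *ₚ-cong
        ; *-assoc = *ₚ-assoc
        ; *-identity = *ₚ-identityˡ , (λ f → ≋-trans (*ₚ-comm f _) (*ₚ-identityˡ f))
        ; distrib = *ₚ-distribˡ , (λ f g h → *ₚ-distribʳ g h f) }
      ; *-comm = *ₚ-comm } }

  -- The solver is only given the syntactic zero test: equality mod p of
  -- constants is not decided by evaluation, since p is a variable.
  ring : AlmostCommutativeRing 0ℓ 0ℓ
  ring = fromCommutativeRing +ₚ-*ₚ-commutativeRing is-[]
    where
    is-[] : (f : Poly) → Maybe ([] ≋ f)
    is-[] []      = just ≋-refl
    is-[] (_ ∷ _) = nothing

  open CommutativeRing +ₚ-*ₚ-commutativeRing using (+-group; +-abelianGroup) renaming (*-identityʳ to *ₚ-identityʳ)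
  open import Algebra.Properties.Group +-group using (//-rightDividesˡ)
  open import Algebra.Properties.AbelianGroup +-abelianGroup using (xyx⁻¹≈y)

  C-cong : ∀ {a b} → a % p ≡ b % p → C a ≋ C b
  C-cong a≡b = ∷-cong a≡b ≋-refl

  C-*ₚ : ∀ a b → C a *ₚ C b ≋ C (a * b)
  C-*ₚ a b = ∷-cong (cong (_% p) (+-identityʳ (a * b))) ≋-refl

  -ₚ≋C[p∸1]*ₚ : ∀ f → -ₚ f ≋ C (p ∸ 1) *ₚ f
  -ₚ≋C[p∸1]*ₚ f = ≋-sym (C*ₚ≋scale (p ∸ 1) f)

  C1+C[p∸1]≋0 : C 1 +ₚ C (p ∸ 1) ≋ []
  C1+C[p∸1]≋0 = mk≋ λ { zero → trans (cong (_% p) 1+[p∸1]≡p) (trans (n%n≡0 p) (sym 0%p≡0)) ; (suc k) → refl }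

  -- Identities involving −1 are proved by the solver with a variable in place
  -- of C (p ∸ 1), leaving a multiple of C 1 +ₚ C (p ∸ 1) that this removes.
  +ₚ-[1+[p∸1]]*ₚ : ∀ f g → f +ₚ (C 1 +ₚ C (p ∸ 1)) *ₚ g ≋ f
  +ₚ-[1+[p∸1]]*ₚ f g = ≋-trans (+ₚ-cong ≋-refl (*ₚ-congˡ _ [] g C1+C[p∸1]≋0)) (+ₚ-identityʳ f)

  infix 4 _∣ₚ_
  record _∣ₚ_ (g f : Poly) : Set where
    constructor divₚ
    field
      quotient : Poly
      equation : f ≋ g *ₚ quotient

  ∣[p]⇒∣ₚ : ∀ {g f} → g ∣[ p ] f → g ∣ₚ f
  ∣[p]⇒∣ₚ (q , f≈gq) = divₚ q (≈⇒≋ f≈gq)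

  ∣ₚ⇒∣[p] : ∀ {g f} → g ∣ₚ f → g ∣[ p ] f
  ∣ₚ⇒∣[p] (divₚ q f≋gq) = q , ≋⇒≈ f≋gq

  ∣ₚ-respʳ : ∀ {g a b} → a ≋ b → g ∣ₚ a → g ∣ₚ b
  ∣ₚ-respʳ a≋b (divₚ q a≋gq) = divₚ q (≋-trans (≋-sym a≋b) a≋gq)

  ∣ₚ-refl : ∀ {g} → g ∣ₚ g
  ∣ₚ-refl {g} = divₚ (C 1) (≋-sym (*ₚ-identityʳ g))

  ∣ₚ-trans : ∀ {g h a} → g ∣ₚ h → h ∣ₚ a → g ∣ₚ a
  ∣ₚ-trans {g} (divₚ q h≋gq) (divₚ q′ a≋hq′) =
    divₚ (q *ₚ q′) (≋-trans a≋hq′ (≋-trans (*ₚ-cong h≋gq ≋-refl) (*ₚ-assoc g q q′)))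

  ∣ₚ-zero : ∀ {g} → g ∣ₚ []
  ∣ₚ-zero {g} = divₚ [] (≋-sym (*ₚ-zeroʳ g))

  ∣ₚ-+ₚ : ∀ {g a b} → g ∣ₚ a → g ∣ₚ b → g ∣ₚ a +ₚ b
  ∣ₚ-+ₚ {g} (divₚ q a≋gq) (divₚ q′ b≋gq′) =
    divₚ (q +ₚ q′) (≋-trans (+ₚ-cong a≋gq b≋gq′) (≋-sym (*ₚ-distribˡ g q q′)))

  ∣ₚ-*ₚ : ∀ {g a} c → g ∣ₚ a → g ∣ₚ c *ₚ a
  ∣ₚ-*ₚ {g} c (divₚ q a≋gq) = divₚ (c *ₚ q) (≋-trans (*ₚ-congʳ c _ _ a≋gq) (x*[y*z]≋y*[x*z] c g q))
    where
    x*[y*z]≋y*[x*z] : ∀ x y z → x *ₚ (y *ₚ z) ≋ y *ₚ (x *ₚ z)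
    x*[y*z]≋y*[x*z] = solve-∀ ring

  ∣ₚ-cancelˡ : ∀ {g a b} → g ∣ₚ a +ₚ b → g ∣ₚ a → g ∣ₚ b
  ∣ₚ-cancelˡ {a = a} {b} g∣a+b g∣a =
    ∣ₚ-respʳ (xyx⁻¹≈y a b) (∣ₚ-+ₚ g∣a+b (∣ₚ-respʳ (≋-sym (-ₚ≋C[p∸1]*ₚ a)) (∣ₚ-*ₚ (C (p ∸ 1)) g∣a)))

  -- Binomials x^e ∓ 1

  X^-*ₚ : ∀ s g → X^ s *ₚ g ≋ shift s g
  X^-*ₚ zero    g = *ₚ-identityˡ g
  X^-*ₚ (suc s) g = ≋-trans (+ₚ-cong (scale-zero g) ≋-refl) (∷-cong refl (X^-*ₚ s g))

  X^-+ : ∀ a b → X^ (a + b) ≋ X^ a *ₚ X^ b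
  X^-+ a b = ≋-sym (≋-trans (X^-*ₚ a (X^ b)) (coeff-≡⇒≋ λ k → cong (λ f → coeff f k) (shift-X^ a)))
    where
    shift-X^ : ∀ a → shift a (X^ b) ≡ X^ (a + b)
    shift-X^ zero    = refl
    shift-X^ (suc a) = cong (0 ∷_) (shift-X^ a)

  X^-1-+ : ∀ a b → X^-1 p (a + b) ≋ X^ a *ₚ X^-1 p b +ₚ X^-1 p a
  X^-1-+ a b = begin
    X^ (a + b) +ₚ C (p ∸ 1)                                        ≈⟨ +ₚ-cong (X^-+ a b) ≋-refl ⟩
    X^ a *ₚ X^ b +ₚ C (p ∸ 1)                                      ≈⟨ +ₚ-[1+[p∸1]]*ₚ _ (X^ a) ⟨
    X^ a *ₚ X^ b +ₚ C (p ∸ 1) +ₚ (C 1 +ₚ C (p ∸ 1)) *ₚ X^ a        ≈⟨ identity (X^ a) (X^ b) (C (p ∸ 1)) ⟩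
    X^ a *ₚ (X^ b +ₚ C (p ∸ 1)) +ₚ (X^ a +ₚ C (p ∸ 1))             ∎
    where
    open ≋-Reasoning
    identity : ∀ x y n → x *ₚ y +ₚ n +ₚ (C 1 +ₚ n) *ₚ x ≋ x *ₚ (y +ₚ n) +ₚ (x +ₚ n)
    identity = solve-∀ ring

  X^-1-[m+m] : ∀ m → X^-1 p (m + m) ≋ X^-1 p m *ₚ X^+1 m
  X^-1-[m+m] m = begin
    X^ (m + m) +ₚ C (p ∸ 1)                                        ≈⟨ +ₚ-cong (X^-+ m m) ≋-refl ⟩
    X^ m *ₚ X^ m +ₚ C (p ∸ 1)                                      ≈⟨ +ₚ-[1+[p∸1]]*ₚ _ (X^ m) ⟨
    X^ m *ₚ X^ m +ₚ C (p ∸ 1) +ₚ (C 1 +ₚ C (p ∸ 1)) *ₚ X^ m        ≈⟨ identity (X^ m) (C (p ∸ 1)) ⟩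
    (X^ m +ₚ C (p ∸ 1)) *ₚ (X^ m +ₚ C 1)                           ∎
    where
    open ≋-Reasoning
    identity : ∀ y n → y *ₚ y +ₚ n +ₚ (C 1 +ₚ n) *ₚ y ≋ (y +ₚ n) *ₚ (y +ₚ C 1)
    identity = solve-∀ ring

  X^+1≋X^-1+C2 : ∀ m → X^+1 m ≋ X^-1 p m +ₚ C 2
  X^+1≋X^-1+C2 m = ≋-sym (≋-trans (+ₚ-assoc (X^ m) (C (p ∸ 1)) (C 2)) (+ₚ-cong ≋-refl (C-cong p∸1+2≡1)))
    where
    p∸1+2≡1 : (p ∸ 1 + 2) % p ≡ 1 % p
    p∸1+2≡1 = begin
      (p ∸ 1 + 2) % p       ≡⟨ cong (_% p) (+-comm (p ∸ 1) 2) ⟩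
      (1 + (1 + (p ∸ 1))) % p ≡⟨ cong (λ n → (1 + n) % p) 1+[p∸1]≡p ⟩
      (1 + p) % p           ≡⟨ [m+n]%n≡m%n 1 p ⟩
      1 % p                 ∎
      where open ≡-Reasoning

  X^-1∣X^-1[q*e] : ∀ e q → X^-1 p e ∣ₚ X^-1 p (q * e)
  X^-1∣X^-1[q*e] e zero    = ∣ₚ-respʳ (≋-sym C1+C[p∸1]≋0) ∣ₚ-zero
  X^-1∣X^-1[q*e] e (suc q) = ∣ₚ-respʳ (≋-sym (X^-1-+ e (q * e)))
    (∣ₚ-+ₚ (∣ₚ-*ₚ (X^ e) (X^-1∣X^-1[q*e] e q)) ∣ₚ-refl)

  ord-∣ : ∀ {g e n} → IsOrd p g e → g ∣ₚ X^-1 p n → e ∣ n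
  ord-∣ {g} {e} {n} (_ , 0<e , g∣X^e-1 , minimal) g∣X^n-1 =
    m%n≡0⇒n∣m n e (decidable-stable (n % e ≟ 0) λ r≢0 →
      minimal (n % e) (n≢0⇒n>0 r≢0) (m%n<n n e) (∣ₚ⇒∣[p] g∣X^r-1))
    where
    instance _ = >-nonZero 0<e
    g∣X^r-1 : g ∣ₚ X^-1 p (n % e)
    g∣X^r-1 = ∣ₚ-cancelˡ
      (∣ₚ-respʳ (X^-1-+ (n % e) (n / e * e)) (subst (λ m → g ∣ₚ X^-1 p m) (m≡m%n+[m/n]*n n e) g∣X^n-1))
      (∣ₚ-*ₚ (X^ (n % e)) (∣ₚ-trans (∣[p]⇒∣ₚ g∣X^e-1) (X^-1∣X^-1[q*e] e (n / e))))

  -- Degrees and division with remainder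

  DegreeBelow : ℕ → Poly → Set
  DegreeBelow n f = ∀ k → n ≤ k → coeff f k % p ≡ 0

  HasDegree : ℕ → Poly → Set
  HasDegree d f = ¬ (coeff f d % p ≡ 0) × DegreeBelow (suc d) f

  degreeBelow-length : ∀ f → DegreeBelow (length f) f
  degreeBelow-length []      k       _         = 0%p≡0
  degreeBelow-length (a ∷ f) (suc k) (s≤s f≤k) = degreeBelow-length f k f≤k

  degreeBelow-mono : ∀ {m n f} → m ≤ n → DegreeBelow m f → DegreeBelow n f
  degreeBelow-mono m≤n f<m k n≤k = f<m k (≤-trans m≤n n≤k)

  degree<degreeBelow : ∀ {d n f} → HasDegree d f → DegreeBelow n f → d < n
  degree<degreeBelow {d} {n} (fd≢0 , _) f<n with n ≤? d
  ... | yes n≤d = ⊥-elim (fd≢0 (f<n d n≤d))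
  ... | no  n≰d = ≰⇒> n≰d

  zero-or-degree : ∀ f → f ≋ [] ⊎ ∃ λ d → HasDegree d f
  zero-or-degree []      = inj₁ ≋-refl
  zero-or-degree (a ∷ f) with zero-or-degree f
  ... | inj₂ (d , fd≢0 , f<1+d) = inj₂ (suc d , fd≢0 , λ { (suc k) (s≤s 1+d≤k) → f<1+d k 1+d≤k })
  ... | inj₁ f≋0 with a % p ≟ 0
  ...   | yes a≡0 = inj₁ (mk≋ λ { zero → trans a≡0 (sym 0%p≡0) ; (suc k) → coeff-≋ f≋0 k })
  ...   | no  a≢0 = inj₂ (0 , a≢0 , λ { (suc k) _ → trans (coeff-≋ f≋0 k) 0%p≡0 })

  hasDegree⇒≉[] : ∀ {d f} → HasDegree d f → ¬ f ≋ []
  hasDegree⇒≉[] (fd≢0 , _) f≋[] = fd≢0 (trans (coeff-≋ f≋[] _) 0%p≡0)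

  module _ {d g w} (g-degree : HasDegree d g) (lead*w≡1 : (coeff g d * w) % p ≡ 1 % p) where

    leading-multiple : ℕ → Poly → Poly
    leading-multiple m c = scale (coeff c m * w) (shift (m ∸ d) g)

    coeff-leading-multiple : ∀ {m} c u → d ≤ m →
                             coeff (leading-multiple m c) (m + u) ≡ coeff c m * w * coeff g (d + u)
    coeff-leading-multiple {m} c u d≤m = begin
      coeff (leading-multiple m c) (m + u)                    ≡⟨ coeff-scale a (shift (m ∸ d) g) (m + u) ⟩
      a * coeff (shift (m ∸ d) g) (m + u)                     ≡⟨ cong (λ i → a * coeff (shift (m ∸ d) g) i) m+u≡[m∸d]+[d+u] ⟩
      a * coeff (shift (m ∸ d) g) (m ∸ d + (d + u))           ≡⟨ cong (a *_) (coeff-shift (m ∸ d) g (d + u)) ⟩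
      a * coeff g (d + u)                                     ∎
      where
      open ≡-Reasoning
      a = coeff c m * w
      m+u≡[m∸d]+[d+u] : m + u ≡ m ∸ d + (d + u)
      m+u≡[m∸d]+[d+u] = trans (cong (_+ u) (sym (m∸n+n≡m d≤m))) (+-assoc (m ∸ d) d u)

    leading-multiple-agrees : ∀ {m c} → d ≤ m → DegreeBelow (suc m) c → ∀ u →
                              coeff c (m + u) % p ≡ coeff (leading-multiple m c) (m + u) % p
    leading-multiple-agrees {m} {c} d≤m c<1+m u =
      trans (agrees u) (cong (_% p) (sym (coeff-leading-multiple c u d≤m)))
      where
      open ≡-Reasoning
      a = coeff c m
      agrees : ∀ u → coeff c (m + u) % p ≡ (a * w * coeff g (d + u)) % p
      agrees zero = begin
        coeff c (m + 0) % p            ≡⟨ cong (λ i → coeff c i % p) (+-identityʳ m) ⟩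
        a % p                          ≡⟨ cong (_% p) (*-identityʳ a) ⟨
        (a * 1) % p                    ≡⟨ %-cong-* {a} refl (trans (cong (_% p) (*-comm w _)) lead*w≡1) ⟨
        (a * (w * coeff g d)) % p      ≡⟨ cong (_% p) (*-assoc a w _) ⟨
        (a * w * coeff g d) % p        ≡⟨ cong (λ i → (a * w * coeff g i) % p) (+-identityʳ d) ⟨
        (a * w * coeff g (d + 0)) % p  ∎
      agrees (suc u) = begin
        coeff c (m + suc u) % p            ≡⟨ c<1+m (m + suc u) (m<m+n m z<s) ⟩
        0                                  ≡⟨ 0%p≡0 ⟨
        0 % p                              ≡⟨ cong (_% p) (*-zeroʳ (a * w)) ⟨
        (a * w * 0) % p                    ≡⟨ %-cong-* {a * w} refl (trans (proj₂ g-degree (d + suc u) (m<m+n d z<s)) (sym 0%p≡0)) ⟨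
        (a * w * coeff g (d + suc u)) % p  ∎

    cancel-leading : ∀ {m c} → d ≤ m → DegreeBelow (suc m) c →
                     DegreeBelow m (c +ₚ -ₚ leading-multiple m c)
    cancel-leading {m} {c} d≤m c<1+m k m≤k = begin
      coeff (c +ₚ -ₚ t) k % p                                ≡⟨ cong (λ i → coeff (c +ₚ -ₚ t) i % p) (m+[n∸m]≡n m≤k) ⟨
      coeff (c +ₚ -ₚ t) (m + u) % p                          ≡⟨ cong (_% p) (coeff-+ₚ c (-ₚ t) (m + u)) ⟩
      (coeff c (m + u) + coeff (-ₚ t) (m + u)) % p           ≡⟨ cong (λ x → (coeff c (m + u) + x) % p) (coeff-scale (p ∸ 1) t (m + u)) ⟩
      (coeff c (m + u) + (p ∸ 1) * coeff t (m + u)) % p      ≡⟨ x+[p∸1]*y%p≡0 (leading-multiple-agrees {m} {c} d≤m c<1+m u) ⟩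
      0                                                      ∎
      where
      open ≡-Reasoning
      t = leading-multiple m c
      u = k ∸ m

    leading-multiple≋ : ∀ m c → leading-multiple m c ≋ g *ₚ (C (coeff c m * w) *ₚ X^ (m ∸ d))
    leading-multiple≋ m c = begin
      scale a (shift (m ∸ d) g)        ≈⟨ scale-cong {a} refl (X^-*ₚ (m ∸ d) g) ⟨
      scale a (X^ (m ∸ d) *ₚ g)        ≈⟨ C*ₚ≋scale a _ ⟨
      C a *ₚ (X^ (m ∸ d) *ₚ g)         ≈⟨ x*[y*z]≋z*[x*y] (C a) (X^ (m ∸ d)) g ⟩
      g *ₚ (C a *ₚ X^ (m ∸ d))         ∎
      where
      open ≋-Reasoning
      a = coeff c m * w
      x*[y*z]≋z*[x*y] : ∀ x y z → x *ₚ (y *ₚ z) ≋ z *ₚ (x *ₚ y)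
      x*[y*z]≋z*[x*y] = solve-∀ ring

    divMod : ∀ n c → DegreeBelow n c → ∃₂ λ q r → c ≋ g *ₚ q +ₚ r × DegreeBelow d r
    divMod n c c<n with n ≤? d
    ... | yes n≤d = [] , c , +ₚ-cong (≋-sym (*ₚ-zeroʳ g)) (≋-refl {c}) , degreeBelow-mono {f = c} n≤d c<n
    divMod zero    c c<n | no 0≰d = ⊥-elim (0≰d z≤n)
    divMod (suc m) c c<n | no n≰d
      with divMod m (c +ₚ -ₚ leading-multiple m c) (cancel-leading {m} {c} (≤-pred (≰⇒> n≰d)) c<n)
    ... | q , r , c′≋gq+r , r<d = q +ₚ t , r , c≋g[q+t]+r , r<d
      where
      t = C (coeff c m * w) *ₚ X^ (m ∸ d)
      open ≋-Reasoning
      c≋g[q+t]+r : c ≋ g *ₚ (q +ₚ t) +ₚ r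
      c≋g[q+t]+r = begin
        c                                                   ≈⟨ //-rightDividesˡ (leading-multiple m c) c ⟨
        c +ₚ -ₚ leading-multiple m c +ₚ leading-multiple m c ≈⟨ +ₚ-cong c′≋gq+r (leading-multiple≋ m c) ⟩
        g *ₚ q +ₚ r +ₚ g *ₚ t                               ≈⟨ x*y+z+x*w≋x*[y+w]+z g q r t ⟩
        g *ₚ (q +ₚ t) +ₚ r                                  ∎
        where
        x*y+z+x*w≋x*[y+w]+z : ∀ x y z w → x *ₚ y +ₚ z +ₚ x *ₚ w ≋ x *ₚ (y +ₚ w) +ₚ z
        x*y+z+x*w≋x*[y+w]+z = solve-∀ ring

  -- Bézout's identity for an irreducible polynomial

  infix 4 _∈⟨_,_⟩
  record _∈⟨_,_⟩ (c f g : Poly) : Set where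
    constructor combination
    field
      coeffˡ coeffʳ : Poly
      equation : c ≋ coeffˡ *ₚ f +ₚ coeffʳ *ₚ g

  module _ {f g : Poly} where

    ∈-resp : ∀ {a b} → a ≋ b → a ∈⟨ f , g ⟩ → b ∈⟨ f , g ⟩
    ∈-resp a≋b (combination u v a≋uf+vg) = combination u v (≋-trans (≋-sym a≋b) a≋uf+vg)

    ∈-left : f ∈⟨ f , g ⟩
    ∈-left = combination (C 1) [] (solve (f ∷ g ∷ []) ring)

    ∈-right : g ∈⟨ f , g ⟩
    ∈-right = combination [] (C 1) (solve (f ∷ g ∷ []) ring)

    ∈-+ₚ : ∀ {a b} → a ∈⟨ f , g ⟩ → b ∈⟨ f , g ⟩ → a +ₚ b ∈⟨ f , g ⟩
    ∈-+ₚ {a} {b} (combination u v a≋) (combination u′ v′ b≋) =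
      combination (u +ₚ u′) (v +ₚ v′) (begin
        a +ₚ b                                              ≈⟨ +ₚ-cong a≋ b≋ ⟩
        u *ₚ f +ₚ v *ₚ g +ₚ (u′ *ₚ f +ₚ v′ *ₚ g)            ≈⟨ solve (u ∷ v ∷ u′ ∷ v′ ∷ f ∷ g ∷ []) ring ⟩
        (u +ₚ u′) *ₚ f +ₚ (v +ₚ v′) *ₚ g                    ∎)
      where open ≋-Reasoning

    ∈-*ₚ : ∀ {a} c → a ∈⟨ f , g ⟩ → c *ₚ a ∈⟨ f , g ⟩
    ∈-*ₚ {a} c (combination u v a≋) =
      combination (c *ₚ u) (c *ₚ v) (begin
        c *ₚ a                               ≈⟨ *ₚ-congʳ c _ _ a≋ ⟩
        c *ₚ (u *ₚ f +ₚ v *ₚ g)              ≈⟨ solve (c ∷ u ∷ v ∷ f ∷ g ∷ []) ring ⟩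
        c *ₚ u *ₚ f +ₚ c *ₚ v *ₚ g           ∎)
      where open ≋-Reasoning

    ∈-remainder : ∀ {a c q r} → a ∈⟨ f , g ⟩ → c ∈⟨ f , g ⟩ → a ≋ c *ₚ q +ₚ r → r ∈⟨ f , g ⟩
    ∈-remainder {a} {c} {q} {r} a∈ c∈ a≋cq+r = ∈-resp r≋a-cq (∈-+ₚ a∈ (∈-*ₚ (C (p ∸ 1)) (∈-*ₚ q c∈)))
      where
      open ≋-Reasoning
      r≋a-cq : a +ₚ C (p ∸ 1) *ₚ (q *ₚ c) ≋ r
      r≋a-cq = begin
        a +ₚ C (p ∸ 1) *ₚ (q *ₚ c)            ≈⟨ +ₚ-cong a≋cq+r (*ₚ-congʳ (C (p ∸ 1)) _ _ (*ₚ-comm q c)) ⟩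
        c *ₚ q +ₚ r +ₚ C (p ∸ 1) *ₚ (c *ₚ q)  ≈⟨ +ₚ-cong (≋-refl {c *ₚ q +ₚ r}) (-ₚ≋C[p∸1]*ₚ (c *ₚ q)) ⟨
        c *ₚ q +ₚ r +ₚ -ₚ (c *ₚ q)            ≈⟨ xyx⁻¹≈y (c *ₚ q) r ⟩
        r                                     ∎


  1∈-*ₚ : ∀ {f₁ f₂ g} → C 1 ∈⟨ f₁ , g ⟩ → C 1 ∈⟨ f₂ , g ⟩ → C 1 ∈⟨ f₁ *ₚ f₂ , g ⟩
  1∈-*ₚ {f₁} {f₂} {g} (combination u₁ v₁ 1≋₁) (combination u₂ v₂ 1≋₂) =
    combination (u₁ *ₚ u₂) (v₁ *ₚ (u₂ *ₚ f₂) +ₚ u₁ *ₚ f₁ *ₚ v₂ +ₚ v₁ *ₚ v₂ *ₚ g) (begin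
      C 1                                                       ≈⟨ *ₚ-identityʳ (C 1) ⟨
      C 1 *ₚ C 1                                                ≈⟨ *ₚ-cong 1≋₁ 1≋₂ ⟩
      (u₁ *ₚ f₁ +ₚ v₁ *ₚ g) *ₚ (u₂ *ₚ f₂ +ₚ v₂ *ₚ g)            ≈⟨ solve (u₁ ∷ v₁ ∷ u₂ ∷ v₂ ∷ f₁ ∷ f₂ ∷ g ∷ []) ring ⟩
      u₁ *ₚ u₂ *ₚ (f₁ *ₚ f₂) +ₚ (v₁ *ₚ (u₂ *ₚ f₂) +ₚ u₁ *ₚ f₁ *ₚ v₂ +ₚ v₁ *ₚ v₂ *ₚ g) *ₚ g  ∎)
    where open ≋-Reasoning

  1∈-^ₚ : ∀ {f g} → C 1 ∈⟨ f , g ⟩ → ∀ h → C 1 ∈⟨ f ^ₚ h , g ⟩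
  1∈-^ₚ 1∈ zero    = ∈-left
  1∈-^ₚ 1∈ (suc h) = 1∈-*ₚ 1∈ (1∈-^ₚ 1∈ h)

  coprime-∣ : ∀ {f a g} → C 1 ∈⟨ f , g ⟩ → f ∣ₚ a *ₚ g → f ∣ₚ a
  coprime-∣ {f} {a} {g} (combination u v 1≋uf+vg) (divₚ q ag≋fq) = divₚ (a *ₚ u +ₚ v *ₚ q) (begin
      a                                 ≈⟨ *ₚ-identityʳ a ⟨
      a *ₚ C 1                          ≈⟨ *ₚ-congʳ a _ _ 1≋uf+vg ⟩
      a *ₚ (u *ₚ f +ₚ v *ₚ g)           ≈⟨ solve (a ∷ u ∷ f ∷ v ∷ g ∷ []) ring ⟩
      f *ₚ (a *ₚ u) +ₚ v *ₚ (a *ₚ g)    ≈⟨ +ₚ-cong (≋-refl {f *ₚ (a *ₚ u)}) (*ₚ-congʳ v _ _ ag≋fq) ⟩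
      f *ₚ (a *ₚ u) +ₚ v *ₚ (f *ₚ q)    ≈⟨ solve (a ∷ u ∷ f ∷ v ∷ q ∷ []) ring ⟩
      f *ₚ (a *ₚ u +ₚ v *ₚ q)           ∎)
    where open ≋-Reasoning

  module _ (p-prime : Prime p) where

    divides-or-remainder : ∀ {f g c d a n} → HasDegree d c → c ∈⟨ f , g ⟩ → a ∈⟨ f , g ⟩ → DegreeBelow n a →
      c ∣ₚ a ⊎ ∃ λ r → r ∈⟨ f , g ⟩ × DegreeBelow d r × ¬ r ≋ []
    divides-or-remainder {c = c} {d} {a} c-degree c∈ a∈ a<n
      with %-inverse p-prime (coeff c d) (proj₁ c-degree)
    ... | w , lead*w≡1 with divMod {d} {c} {w} c-degree lead*w≡1 _ a a<n
    ... | q , r , a≋cq+r , r<d with zero-or-degree r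
    ...   | inj₁ r≋[] = inj₁ (divₚ q (≋-trans a≋cq+r (≋-trans (+ₚ-cong (≋-refl {c *ₚ q}) r≋[]) (+ₚ-identityʳ _))))
    ...   | inj₂ (_ , r-degree) = inj₂ (r , ∈-remainder a∈ c∈ a≋cq+r , r<d , hasDegree⇒≉[] r-degree)

    euclid : ∀ {f g} n c → c ∈⟨ f , g ⟩ → DegreeBelow n c → ¬ c ≋ [] →
             ∃ λ h → h ∈⟨ f , g ⟩ × h ∣ₚ f × h ∣ₚ g
    euclid zero c _ c<0 c≉[] = ⊥-elim (c≉[] (mk≋ λ k → trans (c<0 k z≤n) (sym 0%p≡0)))
    euclid {f} {g} (suc n) c c∈ c<1+n c≉[] with zero-or-degree c
    ... | inj₁ c≋[] = ⊥-elim (c≉[] c≋[])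
    ... | inj₂ (d , c-degree)
      with ≤-pred (degree<degreeBelow {f = c} c-degree c<1+n)
         | divides-or-remainder c-degree c∈ ∈-left (degreeBelow-length f)
         | divides-or-remainder c-degree c∈ ∈-right (degreeBelow-length g)
    ... | d≤n | inj₂ (r , r∈ , r<d , r≉[]) | _ = euclid n r r∈ (degreeBelow-mono {f = r} d≤n r<d) r≉[]
    ... | d≤n | inj₁ _ | inj₂ (r , r∈ , r<d , r≉[]) = euclid n r r∈ (degreeBelow-mono {f = r} d≤n r<d) r≉[]
    ... | _ | inj₁ c∣f | inj₁ c∣g = c , c∈ , c∣f , c∣g

    unit-inverse : ∀ {u} → IsUnit p u → ∃ λ w → C 1 ≋ u *ₚ C w
    unit-inverse {u} (p∤u₀ , p∣uₖ) with %-inverse p-prime (coeff u 0) (λ u₀≡0 → p∤u₀ (m%n≡0⇒n∣m _ p u₀≡0))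
    ... | w , u₀*w≡1 = w , (begin
      C 1                   ≈⟨ C-cong u₀*w≡1 ⟨
      C (coeff u 0 * w)     ≈⟨ C-*ₚ (coeff u 0) w ⟨
      C (coeff u 0) *ₚ C w  ≈⟨ *ₚ-congˡ _ _ (C w) u≋C[u₀] ⟨
      u *ₚ C w              ∎)
      where
      open ≋-Reasoning
      u≋C[u₀] : u ≋ C (coeff u 0)
      u≋C[u₀] = mk≋ λ { zero → refl ; (suc k) → trans (n∣m⇒m%n≡0 _ p (p∣uₖ (suc k) z<s)) (sym 0%p≡0) }

    ∣ₚ-unit-factor : ∀ {f h k} → f ≋ h *ₚ k → IsUnit p k → f ∣ₚ h
    ∣ₚ-unit-factor {f} {h} {k} f≋hk k-unit with unit-inverse {k} k-unit
    ... | w , 1≋kw = divₚ (C w) (begin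
      h                  ≈⟨ *ₚ-identityʳ h ⟨
      h *ₚ C 1           ≈⟨ *ₚ-congʳ h _ _ 1≋kw ⟩
      h *ₚ (k *ₚ C w)    ≈⟨ *ₚ-assoc h k (C w) ⟨
      h *ₚ k *ₚ C w      ≈⟨ *ₚ-congˡ _ _ (C w) f≋hk ⟨
      f *ₚ C w           ∎)
      where open ≋-Reasoning

    irreducible⇒1∈ : ∀ {f g} → Irreducible p f → ¬ f ∣ₚ g → C 1 ∈⟨ f , g ⟩
    irreducible⇒1∈ {f} {g} (_ , _ , f-irreducible) f∤g with zero-or-degree g
    ... | inj₁ g≋[] = ⊥-elim (f∤g (∣ₚ-respʳ (≋-sym g≋[]) ∣ₚ-zero))
    ... | inj₂ (d , g-degree) with euclid (suc d) g ∈-right (proj₂ g-degree) (hasDegree⇒≉[] g-degree)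
    ... | h , h∈ , divₚ k f≋hk , h∣g with f-irreducible h k (≋⇒≈ f≋hk)
    ...   | inj₂ k-unit = ⊥-elim (f∤g (∣ₚ-trans (∣ₚ-unit-factor f≋hk k-unit) h∣g))
    ...   | inj₁ h-unit with unit-inverse {h} h-unit
    ...     | w , 1≋hw = ∈-resp (≋-sym (≋-trans 1≋hw (*ₚ-comm h (C w)))) (∈-*ₚ (C w) h∈)

    irreducible-∣ : ∀ {f a g} → Irreducible p f → ¬ f ∣ₚ g → f ∣ₚ a *ₚ g → f ∣ₚ a
    irreducible-∣ f-irr f∤g = coprime-∣ (irreducible⇒1∈ f-irr f∤g)

    irreducible-^ₚ-∣ : ∀ {f a g} → Irreducible p f → ¬ f ∣ₚ g → ∀ h → f ^ₚ h ∣ₚ a *ₚ g → f ^ₚ h ∣ₚ a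
    irreducible-^ₚ-∣ f-irr f∤g h = coprime-∣ (1∈-^ₚ (irreducible⇒1∈ f-irr f∤g) h)

    ord-even⇒∣[X^half+1]*[X^half-1] : ∀ {g e} → IsOrd p g e → 2 ∣ e → g ∣ₚ X^+1 (e / 2) *ₚ X^-1 p (e / 2)
    ord-even⇒∣[X^half+1]*[X^half-1] {g} {e} (_ , _ , g∣X^e-1 , _) 2∣e = ∣ₚ-respʳ X^-1[e]≋ (∣[p]⇒∣ₚ g∣X^e-1)
      where
      open ≋-Reasoning
      X^-1[e]≋ : X^-1 p e ≋ X^+1 (e / 2) *ₚ X^-1 p (e / 2)
      X^-1[e]≋ = begin
        X^-1 p e                          ≡⟨ cong (X^-1 p) (n/2+n/2≡n 2∣e) ⟨
        X^-1 p (e / 2 + e / 2)            ≈⟨ X^-1-[m+m] (e / 2) ⟩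
        X^-1 p (e / 2) *ₚ X^+1 (e / 2)    ≈⟨ *ₚ-comm (X^-1 p (e / 2)) _ ⟩
        X^+1 (e / 2) *ₚ X^-1 p (e / 2)    ∎

    ord-even⇒∤X^half-1 : ∀ {g e} → IsOrd p g e → 2 ∣ e → ¬ g ∣ₚ X^-1 p (e / 2)
    ord-even⇒∤X^half-1 {e = e} (_ , 0<e , _ , minimal) 2∣e g∣X^m-1 =
      minimal (e / 2) (0<n/2 2∣e 0<e) (n/2<n 0<e) (∣ₚ⇒∣[p] g∣X^m-1)

    ord>1⇒∤C1 : ∀ {g e} → IsOrd p g e → 1 < e → ¬ g ∣ₚ C 1
    ord>1⇒∤C1 (_ , _ , _ , minimal) 1<e g∣1 =
      minimal 1 z<s 1<e (∣ₚ⇒∣[p] (∣ₚ-respʳ (*ₚ-identityʳ (X^-1 p 1)) (∣ₚ-*ₚ (X^-1 p 1) g∣1)))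

    2%p≢0 : ¬ 2 ∣ p → ¬ (2 % p ≡ 0)
    2%p≢0 p-odd 2%p≡0 = p-odd (subst (2 ∣_) (sym p≡2) ∣-refl)
      where
      p≡2 : p ≡ 2
      p≡2 = ≤-antisym (∣⇒≤ (m%n≡0⇒n∣m 2 p 2%p≡0)) (nonTrivial⇒n>1 p {{prime⇒nonTrivial p-prime}})

    ∣X^-1∧∣X^+1⇒∣C1 : ¬ 2 ∣ p → ∀ {g m} → g ∣ₚ X^-1 p m → g ∣ₚ X^+1 m → g ∣ₚ C 1
    ∣X^-1∧∣X^+1⇒∣C1 p-odd {m = m} g∣X^m-1 g∣X^m+1 with %-inverse p-prime 2 (2%p≢0 p-odd)
    ... | w , 2*w≡1 = ∣ₚ-respʳ (≋-trans (C-*ₚ w 2) (C-cong (trans (cong (_% p) (*-comm w 2)) 2*w≡1)))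
      (∣ₚ-*ₚ (C w) (∣ₚ-cancelˡ (∣ₚ-respʳ (X^+1≋X^-1+C2 m) g∣X^m+1) g∣X^m-1))

    irreducible-ord-even⇒∣X^+1 : ∀ {f e} → Irreducible p f → IsOrd p f e → 2 ∣ e → f ∣ₚ X^+1 (e / 2)
    irreducible-ord-even⇒∣X^+1 f-irr f-ord 2∣e =
      irreducible-∣ f-irr (ord-even⇒∤X^half-1 f-ord 2∣e) (ord-even⇒∣[X^half+1]*[X^half-1] f-ord 2∣e)

    irreducible-ord-even⇒^ₚ-∣X^+1 : ¬ 2 ∣ p → ∀ {f e₀} → Irreducible p f → IsOrd p f e₀ → 2 ∣ e₀ →
      ∀ h → 0 < h → ∀ {e} → IsOrd p (f ^ₚ h) e → f ^ₚ h ∣ₚ X^+1 (e / 2)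
    irreducible-ord-even⇒^ₚ-∣X^+1 p-odd {f} {e₀} f-irr f-ord 2∣e₀ h@(suc h′) _ {e} fʰ-ord =
      irreducible-^ₚ-∣ f-irr f∤X^m-1 h (ord-even⇒∣[X^half+1]*[X^half-1] fʰ-ord 2∣e)
      where
      f∣X^e-1 : f ∣ₚ X^-1 p e
      f∣X^e-1 = ∣ₚ-trans (divₚ (f ^ₚ h′) ≋-refl) (∣[p]⇒∣ₚ (proj₁ (proj₂ (proj₂ fʰ-ord))))
      2∣e : 2 ∣ e
      2∣e = ∣-trans 2∣e₀ (ord-∣ f-ord f∣X^e-1)
      f∤X^m-1 : ¬ f ∣ₚ X^-1 p (e / 2)
      f∤X^m-1 f∣X^m-1 = ord-even⇒∤X^half-1 fʰ-ord 2∣e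
        (irreducible-^ₚ-∣ f-irr f∤X^m+1 h (∣ₚ-respʳ (*ₚ-comm (X^+1 (e / 2)) _) (ord-even⇒∣[X^half+1]*[X^half-1] fʰ-ord 2∣e)))
        where
        f∤X^m+1 : ¬ f ∣ₚ X^+1 (e / 2)
        f∤X^m+1 f∣X^m+1 = ord>1⇒∤C1 f-ord (∣⇒≤ {{>-nonZero (proj₁ (proj₂ f-ord))}} 2∣e₀)
          (∣X^-1∧∣X^+1⇒∣C1 p-odd f∣X^m-1 f∣X^m+1)

lemma5p3 : (p i j : ℕ) → Prime p → ¬ (2 ∣ p) → 0 < i → 0 < j →
    (2 ^ j ∣ p ^ i ∸ 1) → (f : Poly) → InA p i j f →
    (∀ e → IsOrd p f e → f ∣[ p ] X^+1 (e / 2)) ×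
    (∀ h → 0 < h → ∀ e → IsOrd p (f ^ₚ h) e → (f ^ₚ h) ∣[ p ] X^+1 (e / 2))
lemma5p3 p i (suc j) p-prime p-odd _ _ _ f (_ , f-irr , ord-valuation , e₀ , f-ord) =
    (λ e f-ord′ → ∣ₚ⇒∣[p] (irreducible-ord-even⇒∣X^+1 p-prime {f} f-irr f-ord′ (2∣ord f-ord′)))
  , (λ h 0<h e fʰ-ord → ∣ₚ⇒∣[p]
      (irreducible-ord-even⇒^ₚ-∣X^+1 p-prime p-odd {f} f-irr f-ord (2∣ord f-ord) h 0<h fʰ-ord))
  where
  instance _ = prime⇒nonZero p-prime
  open Polynomials p
  2∣ord : ∀ {e} → IsOrd p f e → 2 ∣ e
  2∣ord f-ord = ∣-trans (m∣m*n (2 ^ j)) (proj₁ (ord-valuation _ f-ord))
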